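{- If $p\ge 4$ is even and $n\ge 2$, then $\gamma_t(S_p^n)=p^{n-1}$.
   Context: $\gamma_t(G)$ is the total domination number: the minimum size of $S\subseteq V(G)$ such that every vertex of $G$ has a neighbor in $S$. For $p\ge1$, $n\ge1$, the Sierpiński graph $S_p^n$ has vertex set $\{0,\dots,p-1\}^n$, vertices written $s=s_n\ldots s_1$; vertices $s_n\ldots s_1$ and $t_n\ldots t_1$ are adjacent iff there is $\delta\in\{1,\dots,n\}$ such that $s_d=t_d$ for $d>\delta$, $s_\delta\ne t_\delta$, and $s_d=t_\delta$, $t_d=s_\delta$ for all $d<\delta$. -}

module Defs where

open import Data.Nat using (ℕ; zero; suc; _≤_)
open import Data.Empty using (⊥)
open import Data.Fin using (Fin)
open import Data.Vec using (Vec; []; _∷_)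
open import Data.Vec.Relation.Unary.All using (All)
open import Data.List using (List; length)
open import Data.List.Membership.Propositional using (_∈_)
open import Data.List.Relation.Unary.Unique.Propositional using (Unique)
open import Data.Product using (Σ; _×_; ∃-syntax)
open import Data.Sum using (_⊎_)
open import Relation.Binary.PropositionalEquality using (_≡_; _≢_)

-- Vertices of S_p^n: words s_n ... s_1 over {0,...,p-1}; the head of the
-- vector is s_n (the most significant letter).
Vertex : ℕ → ℕ → Set
Vertex p n = Vec (Fin p) n

-- Adjacency in S_p^n, exactly as in the paper: s ~ t iff there is δ with
-- s_d = t_d for d > δ, s_δ ≠ t_δ, and s_d = t_δ, t_d = s_δ for d < δ.
-- Recursively on the leading letter: either the leading letters agree
-- (so δ < n) and the tails are adjacent, or they differ (δ = n) and the
-- tail of s is constantly t_n and the tail of t is constantly s_n.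
Adj : {p n : ℕ} → Vertex p n → Vertex p n → Set
Adj [] [] = ⊥
Adj {p} (s ∷ ss) (t ∷ tt) =
  (s ≡ t × Adj ss tt) ⊎ (s ≢ t × All (_≡ t) ss × All (_≡ s) tt)

-- A finite vertex set, given as a duplicate-free list; its size is its length.
-- S is a total dominating set: every vertex has a neighbour in S.
IsTotalDominating : {p n : ℕ} → List (Vertex p n) → Set
IsTotalDominating {p} {n} S = (v : Vertex p n) → ∃[ u ] (u ∈ S × Adj v u)

TotalDominationNumberIs : (p n k : ℕ) → Set
TotalDominationNumberIs p n k =
  (Σ (List (Vertex p n)) λ S → Unique S × IsTotalDominating S × length S ≡ k)
  × ((S : List (Vertex p n)) → Unique S → IsTotalDominating S → k ≤ length S)

-- Every vertex u has at most p neighbours: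
-- the function 'neighbour u i' (i : Fin p) lists candidates, and every
-- neighbour v of u equals 'neighbour u i' for some i.  If S totally
-- dominates, each vertex v is therefore recovered from a code (position of a
-- neighbour of v in S, letter i), so p^n vertices inject into |S|·p codes.
--
-- Upper bound (any p admitting a fixed-point-free involution σ on letters,
-- n ≥ 2).  Let 'extend w = w σ(w₁)' append the partner of the last letter.
-- The p^(n-1) words 'extend w' totally dominate S_p^n: a vertex ending in
-- x σ(x) is adjacent to (prefix) σ(x) x, and any other vertex ending in x y
-- is adjacent to (prefix) x σ(x) through a change of its last letter.
-- For even p, 'opposite' (i ↦ p-1-i) is such an involution.
module Submission where

open import Defs
open import Data.Nat using (ℕ; zero; suc; _≤_; _∸_; _^_; _*_; _+_; s≤s; z≤n; NonZero; >-nonZero)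
open import Data.Nat.Divisibility using (_∣_; divides)
open import Data.Nat.Properties using (*-cancelʳ-≤; *-comm; ≤-trans; m+[n∸m]≡n; +-identityʳ; even≢odd)
open import Data.Fin using (Fin; combine; remQuot; opposite; toℕ; finToFun; funToFin)
open import Data.Fin.Properties
  using (remQuot-combine; finToFun-funToFin; funToFin-finToFin; injective⇒≤; opposite-involutive; opposite-prop; _≟_; toℕ<n)
open import Data.Vec using ([]; _∷_; head; tail; replicate; lookup; tabulate)
open import Data.Vec.Properties using (tabulate-cong; lookup∘tabulate; tabulate∘lookup)
open import Data.Vec.Relation.Unary.All using (All; []; _∷_; all?)
import Data.Fin as Fin
import Data.List as List
open import Data.List using (List; length; map; allFin)
open import Data.List.Properties using (length-map; length-tabulate)
open import Data.List.Membership.Propositional using (_∈_)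
open import Data.List.Membership.Propositional.Properties using (∈-map⁺; ∈-allFin)
open import Data.List.Relation.Unary.Unique.Propositional using (Unique)
open import Data.List.Relation.Unary.Unique.Propositional.Properties using (map⁺; allFin⁺)
open import Data.List.Relation.Unary.Any using (index)
open import Data.List.Relation.Unary.Any.Properties using (lookup-index)
open import Data.Product using (∃-syntax; _×_; _,_; proj₁)
open import Data.Sum using (inj₁; inj₂)
open import Function using (_∘_)
open import Relation.Nullary using (¬_; yes; no; contradiction)
open import Relation.Binary.PropositionalEquality

module _ {p : ℕ} where

  vertex : ∀ n → Fin (p ^ n) → Vertex p n
  vertex n = tabulate ∘ finToFun

  code : ∀ {n} → Vertex p n → Fin (p ^ n)
  code = funToFin ∘ lookup

  vertex-code : ∀ {n} (v : Vertex p n) → vertex n (code v) ≡ v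
  vertex-code v = trans (tabulate-cong (finToFun-funToFin (lookup v))) (tabulate∘lookup v)

  funToFin-cong : ∀ {m} {f g : Fin m → Fin p} → (∀ i → f i ≡ g i) → funToFin f ≡ funToFin g
  funToFin-cong {zero}  eq = refl
  funToFin-cong {suc m} eq = cong₂ combine (eq Fin.zero) (funToFin-cong (eq ∘ Fin.suc))

  vertex-injective : ∀ n {i j : Fin (p ^ n)} → vertex n i ≡ vertex n j → i ≡ j
  vertex-injective n {i} {j} eq = begin
    i                                ≡⟨ funToFin-finToFin {n} i ⟨
    funToFin (finToFun {p} {n} i)    ≡⟨ funToFin-cong same-letters ⟩
    funToFin (finToFun {p} {n} j)    ≡⟨ funToFin-finToFin {n} j ⟩
    j                                ∎
    where
      open ≡-Reasoning
      same-letters : ∀ k → finToFun i k ≡ finToFun j k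
      same-letters k = begin
        finToFun i k          ≡⟨ lookup∘tabulate (finToFun i) k ⟨
        lookup (vertex n i) k ≡⟨ cong (λ v → lookup v k) eq ⟩
        lookup (vertex n j) k ≡⟨ lookup∘tabulate (finToFun j) k ⟩
        finToFun j k          ∎

  vertices-≤ : ∀ {n k} (f : Vertex p n → Fin k) (g : Fin k → Vertex p n) →
               (∀ v → g (f v) ≡ v) → p ^ n ≤ k
  vertices-≤ {n} f g gf = injective⇒≤ {f = f ∘ vertex n}
    λ {i} {j} eq → vertex-injective n (trans (sym (gf (vertex n i))) (trans (cong g eq) (gf (vertex n j))))

  allVertices : ∀ n → List (Vertex p n)
  allVertices n = map (vertex n) (allFin (p ^ n))

  allVertices-unique : ∀ n → Unique (allVertices n)
  allVertices-unique n = map⁺ (vertex-injective n) (allFin⁺ (p ^ n))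

  allVertices-length : ∀ n → length (allVertices n) ≡ p ^ n
  allVertices-length n = trans (length-map (vertex n) (allFin (p ^ n))) (length-tabulate (λ i → i))

  ∈-allVertices : ∀ {n} (v : Vertex p n) → v ∈ allVertices n
  ∈-allVertices {n} v = subst (_∈ allVertices n) (vertex-code v) (∈-map⁺ (vertex n) (∈-allFin (code v)))

  -- The i-th neighbour candidate of u: if the tail of u is constantly i and
  -- the leading letter a differs from i, flip to i a…a (the neighbour across
  -- the top level); otherwise keep a and recurse.  At the last letter this
  -- replaces u₁ by i.
  neighbour : ∀ {n} → Vertex p n → Fin p → Vertex p n
  neighbour [] i = []
  neighbour (a ∷ us) i with all? (_≟ i) us | a ≟ i
  ... | yes _ | no _ = i ∷ replicate _ a
  ... | _     | _    = a ∷ neighbour us i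

  neighbour-keep : ∀ {n} (a i : Fin p) (us : Vertex p n) →
                   ¬ All (_≡ i) us → neighbour (a ∷ us) i ≡ a ∷ neighbour us i
  neighbour-keep a i us ¬all with all? (_≟ i) us | a ≟ i
  ... | yes all | _    = contradiction all ¬all
  ... | no _    | _    = refl

  neighbour-flip : ∀ {n} (a i : Fin p) (us : Vertex p n) →
                   All (_≡ i) us → a ≢ i → neighbour (a ∷ us) i ≡ i ∷ replicate _ a
  neighbour-flip a i us all a≢i with all? (_≟ i) us | a ≟ i
  ... | yes _    | no _    = refl
  ... | yes _    | yes a≡i = contradiction a≡i a≢i
  ... | no ¬all  | _       = contradiction all ¬all

  constant : ∀ {n} {a : Fin p} (vs : Vertex p n) → All (_≡ a) vs → vs ≡ replicate n a
  constant []       []         = refl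
  constant (v ∷ vs) (v≡a ∷ all) = cong₂ _∷_ v≡a (constant vs all)

  -- Every neighbour of u is some candidate 'neighbour u i', with u not
  -- constantly i (the invariant making the recursion go through).
  neighbour-complete : ∀ {n} (v u : Vertex p n) → Adj v u →
                       ∃[ i ] (v ≡ neighbour u i × ¬ All (_≡ i) u)
  neighbour-complete [] [] ()
  neighbour-complete (x ∷ vs) (a ∷ us) (inj₁ (refl , adj))
    with neighbour-complete vs us adj
  ... | i , vs≡ , ¬all =
    i , trans (cong (x ∷_) vs≡) (sym (neighbour-keep x i us ¬all)) , λ { (_ ∷ all) → ¬all all }
  neighbour-complete (x ∷ vs) (a ∷ us) (inj₂ (x≢a , vs≡a , us≡x)) =
    x , trans (cong (x ∷_) (constant vs vs≡a)) (sym (neighbour-flip a x us us≡x (x≢a ∘ sym))) ,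
    λ { (a≡x ∷ _) → x≢a (sym a≡x) }

  total-domination-lower : ∀ n .{{_ : NonZero p}} (S : List (Vertex p (suc n))) →
                           IsTotalDominating S → p ^ n ≤ length S
  total-domination-lower n S dom =
    *-cancelʳ-≤ (p ^ n) (length S) p (subst (_≤ length S * p) (*-comm p (p ^ n)) (vertices-≤ enc dec dec-enc))
    where
      enc : Vertex p (suc n) → Fin (length S * p)
      enc v with dom v
      ... | u , u∈S , adj = combine (index u∈S) (proj₁ (neighbour-complete v u adj))
      decode : Fin (length S) × Fin p → Vertex p (suc n)
      decode (j , i) = neighbour (List.lookup S j) i
      dec : Fin (length S * p) → Vertex p (suc n)
      dec c = decode (remQuot p c)
      dec-enc : ∀ v → dec (enc v) ≡ v
      dec-enc v with dom v
      ... | u , u∈S , adj with neighbour-complete v u adj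
      ... | i , v≡ , _ = begin
        decode (remQuot p (combine (index u∈S) i))  ≡⟨ cong decode (remQuot-combine (index u∈S) i) ⟩
        neighbour (List.lookup S (index u∈S)) i      ≡⟨ cong (λ w → neighbour w i) (lookup-index u∈S) ⟨
        neighbour u i                                ≡⟨ v≡ ⟨
        v                                            ∎
        where open ≡-Reasoning

  module Partner (σ : Fin p → Fin p) (σ-involutive : ∀ x → σ (σ x) ≡ x) (σ-no-fixpoint : ∀ x → σ x ≢ x) where

    extend : ∀ {k} → Vertex p (suc k) → Vertex p (suc (suc k))
    extend (x ∷ [])    = x ∷ σ x ∷ []
    extend (a ∷ b ∷ w) = a ∷ extend (b ∷ w)

    extend-injective : ∀ {k} {w w' : Vertex p (suc k)} → extend w ≡ extend w' → w ≡ w'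
    extend-injective {w = x ∷ []}    {x' ∷ []}      refl = refl
    extend-injective {w = a ∷ b ∷ w} {a' ∷ b' ∷ w'} eq =
      cong₂ _∷_ (cong head eq) (extend-injective (cong tail eq))

    adjacent-extension : ∀ {k} (v : Vertex p (suc (suc k))) → ∃[ w ] Adj v (extend w)
    adjacent-extension (x ∷ y ∷ []) with y ≟ σ x
    ... | yes refl = σ x ∷ [] , inj₂ ((σ-no-fixpoint x ∘ sym) , refl ∷ [] , σ-involutive x ∷ [])
    ... | no y≢σx  = x ∷ [] , inj₁ (refl , inj₂ (y≢σx , [] , []))
    adjacent-extension (a ∷ b ∷ c ∷ v) with adjacent-extension (b ∷ c ∷ v)
    ... | b' ∷ w , adj = a ∷ b' ∷ w , inj₁ (refl , adj)

    extensions : ∀ k → List (Vertex p (suc (suc k)))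
    extensions k = map extend (allVertices (suc k))

    extensions-unique : ∀ k → Unique (extensions k)
    extensions-unique k = map⁺ extend-injective (allVertices-unique (suc k))

    extensions-length : ∀ k → length (extensions k) ≡ p ^ suc k
    extensions-length k = trans (length-map extend (allVertices (suc k))) (allVertices-length (suc k))

    extensions-dominating : ∀ k → IsTotalDominating (extensions k)
    extensions-dominating k v with adjacent-extension v
    ... | w , adj = extend w , ∈-map⁺ extend (∈-allVertices w) , adj

-- For even p the reflection i ↦ p-1-i has no fixed point, as p ≠ 2t+1.
opposite-no-fixpoint : ∀ {p} → 2 ∣ p → (x : Fin p) → opposite x ≢ x
opposite-no-fixpoint {p} (divides q p≡q*2) x opp≡x = even≢odd q t (begin
  2 * q               ≡⟨ *-comm 2 q ⟩
  q * 2               ≡⟨ p≡q*2 ⟨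
  p                   ≡⟨ m+[n∸m]≡n (toℕ<n x) ⟨
  suc t + (p ∸ suc t) ≡⟨ cong (suc t +_) t≡ ⟨
  suc (t + t)         ≡⟨ cong (λ m → suc (t + m)) (+-identityʳ t) ⟨
  suc (2 * t)         ∎)
  where
    open ≡-Reasoning
    t = toℕ x
    t≡ : t ≡ p ∸ suc t
    t≡ = trans (sym (cong toℕ opp≡x)) (opposite-prop x)

corollary5p2 : (p n : ℕ) → 4 ≤ p → 2 ∣ p → 2 ≤ n → TotalDominationNumberIs p n (p ^ (n ∸ 1))
corollary5p2 p zero       _ _ ()
corollary5p2 p (suc zero) _ _ (s≤s ())
corollary5p2 p (suc (suc k)) 4≤p 2∣p _ =
  (extensions k , extensions-unique k , extensions-dominating k , extensions-length k) ,
  λ S _ dom → total-domination-lower (suc k) {{>-nonZero (≤-trans (s≤s z≤n) 4≤p)}} S dom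
  where open Partner {p} opposite opposite-involutive (opposite-no-fixpoint 2∣p)
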